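{- Let $w$ be a word of length $n$ and $A=\pi_w$. Define $\mathrm{f}'[i]=\pi'_w[i-1]+1$ for $1\le i\le n$. Then $\mathrm{f}'^{(3)}[i]<\frac{\mathrm{f}'[i]}{2}$ for all $i$.
   Context: A border of a word is a word that is both a prefix and a suffix of it; it is proper if shorter than the word. $\pi_w[i]$ is the length of the longest proper border of $w[1\dots i]$. The strong failure function $\pi'_w$ is defined by $\pi'_w[n]=\pi_w[n]$, for $1\le i<n$, $\pi'_w[i]$ is the length of the longest proper border $u$ of $w[1\dots i]$ with $w[|u|+1]\neq w[i+1]$ (and $-1$ if none exists), and by convention $\pi'_w[0]=-1$. Thus $\mathrm{f}'[i]\ge 0$, and $\mathrm{f}'[i]=0$ means $i$ has no parent in the forest with edges $i\to\mathrm{f}'[i]$. $\mathrm{f}'^{(k)}$ denotes the $k$-fold composition of $\mathrm{f}'$; the inequality is asserted for those $i$ for which $\mathrm{f}'^{(3)}[i]$ is defined (i.e. $\mathrm{f}'[i]\ge1$ and $\mathrm{f}'^{(2)}[i]\ge 1$). -}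

module Defs where

open import Data.Nat using (ℕ; zero; suc; _∸_; _≡ᵇ_)
open import Data.Bool using (Bool; true; false; if_then_else_; _∧_; not)
open import Data.List using (List; []; _∷_; take; drop; length)
open import Data.Maybe using (Maybe; just; nothing; maybe)
import Data.List.Properties as LP
import Data.Maybe.Properties as MP
open import Relation.Binary.Definitions using (DecidableEquality)
open import Relation.Binary.PropositionalEquality using (_≡_)
open import Relation.Nullary.Decidable using (⌊_⌋)

-- Words are lists over an alphabet A with decidable equality.
-- Positions are 0-based internally: the paper's letter w[j] (1-based) is  at w (j - 1).
at : {A : Set} → List A → ℕ → Maybe A
at []       _       = nothing
at (x ∷ _)  zero    = just x
at (_ ∷ xs) (suc j) = at xs j

maxBelow : (ℕ → Bool) → ℕ → Maybe ℕ
maxBelow P zero    = nothing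
maxBelow P (suc k) = if P k then just k else maxBelow P k

module _ {A : Set} (_≟_ : DecidableEquality A) where

  IsBorderOfLength : List A → ℕ → Set
  IsBorderOfLength u k = take k u ≡ drop (length u ∸ k) u

  borderᵇ : List A → ℕ → Bool
  borderᵇ u k = ⌊ LP.≡-dec _≟_ (take k u) (drop (length u ∸ k) u) ⌋

  π : List A → ℕ → Maybe ℕ
  π w i = maxBelow (borderᵇ (take i w)) i

  -- π'_w[i], with nothing standing for -1.
  π′ : List A → ℕ → Maybe ℕ
  π′ w zero = nothing
  π′ w i@(suc _) =
    if i ≡ᵇ length w then π w i
    else maxBelow (λ k → borderᵇ (take i w) k
                         ∧ not ⌊ MP.≡-dec _≟_ (at w k) (at w i) ⌋) i

  f′ : List A → ℕ → ℕ
  f′ w i = maybe suc 0 (π′ w (i ∸ 1))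

module Submission where

-- Write x = π'[i-1], y = π'[x], z = π'[y], so that f'[i] = x + 1,
-- f'^(2)[i] = y + 1 and f'^(3)[i] = z + 1 (the hypotheses make x and y
-- defined; if z is undefined then f'^(3)[i] = 0 and there is nothing to show).
-- The claim 2(z + 1) < x + 1 follows from  y + z < x  together with z < y.
--
-- A border of length k of the prefix w[0..x) says that the letters of w
-- repeat with period x - k on the first x positions.  So w[0..x) has period
-- p = x - y and w[0..y) has period q = y - z.  If we had x ≤ y + z, i.e.
-- p ≤ z, the two periods would interact (lemma `periods-interact`) and force
-- w[z] = w[y], contradicting the defining property of the strong border z.

open import Defs
open import Data.Nat using (ℕ; zero; suc; _+_; _∸_; _*_; _≤_; _<_; _≡ᵇ_; z≤n; s≤s)
open import Data.Nat.Properties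
open import Data.Bool using (Bool; true; false; _∧_; not; T)
open import Data.Bool.Properties using (T-∧)
open import Data.List using (List; []; _∷_; length; take; drop)
import Data.List.Properties as LP
open import Data.Maybe using (just; nothing)
import Data.Maybe.Properties as MP
open import Data.Product using (_×_; _,_; proj₁; proj₂)
open import Data.Empty using (⊥-elim)
open import Function using (Equivalence)
open import Relation.Nullary using (yes; no)
open import Relation.Nullary.Decidable using (⌊_⌋; toWitness; toWitnessFalse)
open import Relation.Binary.Definitions using (DecidableEquality)
open import Relation.Binary.PropositionalEquality

Periodic : {B : Set} → (ℕ → B) → ℕ → ℕ → Set
Periodic g p len = ∀ m → m < len → g m ≡ g (p + m)

-- Two overlapping periods: if g has period p ≥ 1 on [0, p + r + q) and period
-- q on [0, p + r), then g agrees at p + r and p + r + q.  (Walk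
-- p + r ↦ r ↦ q + r ↦ p + q + r, alternating the two periods.)
periods-interact : {B : Set} (g : ℕ → B) (p q r : ℕ) → 1 ≤ p →
                   Periodic g p (p + r + q) → Periodic g q (p + r) →
                   g (p + r) ≡ g (p + r + q)
periods-interact g p q r 1≤p per-p per-q = begin
  g (p + r)         ≡⟨ sym (per-p r (<-≤-trans (shift r) (m≤m+n (p + r) q))) ⟩
  g r               ≡⟨ per-q r (shift r) ⟩
  g (q + r)         ≡⟨ per-p (q + r) (subst (q + r <_) reassoc (shift (q + r))) ⟩
  g (p + (q + r))   ≡⟨ cong g reassoc ⟩
  g (p + r + q)     ∎
  where
  open ≡-Reasoning
  shift : ∀ n → n < p + n
  shift n = +-monoˡ-< n 1≤p
  reassoc : p + (q + r) ≡ p + r + q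
  reassoc = trans (cong (p +_) (+-comm q r)) (sym (+-assoc p r q))

nested-periods-agree : {B : Set} (g : ℕ → B) {x y z : ℕ} →
                       z < y → y < x → x ≤ y + z →
                       Periodic g (x ∸ y) y → Periodic g (y ∸ z) z →
                       g z ≡ g y
nested-periods-agree g {x} {y} {z} z<y y<x x≤y+z per-xy per-yz =
  subst₂ (λ a b → g a ≡ g b) p+r≡z p+r+q≡y
    (periods-interact g p q r (m<n⇒0<n∸m y<x)
      (subst (Periodic g p) (sym p+r+q≡y) per-xy)
      (subst (Periodic g q) (sym p+r≡z) per-yz))
  where
  p q r : ℕ
  p = x ∸ y
  q = y ∸ z
  r = z ∸ p
  p+r≡z : p + r ≡ z
  p+r≡z = m+[n∸m]≡n (m≤n+o⇒m∸n≤o x y x≤y+z)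
  p+r+q≡y : p + r + q ≡ y
  p+r+q≡y = trans (cong (_+ q) p+r≡z) (m+[n∸m]≡n (<⇒≤ z<y))

at-take : {A : Set} (xs : List A) {n m : ℕ} → m < n → at (take n xs) m ≡ at xs m
at-take []       {suc n} {m}     _         = refl
at-take (x ∷ xs) {suc n} {zero}  _         = refl
at-take (x ∷ xs) {suc n} {suc m} (s≤s m<n) = at-take xs m<n

at-drop : {A : Set} (xs : List A) (d m : ℕ) → at (drop d xs) m ≡ at xs (d + m)
at-drop xs       zero    m = refl
at-drop []       (suc d) m = refl
at-drop (x ∷ xs) (suc d) m = at-drop xs d m

border⇒periodic : {A : Set} (_≟_ : DecidableEquality A) (w : List A) {x k : ℕ} →
                  x ≤ length w → k ≤ x → IsBorderOfLength _≟_ (take x w) k →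
                  Periodic (at w) (x ∸ k) k
border⇒periodic _≟_ w {x} {k} x≤n k≤x border m m<k = begin
  at w m                       ≡⟨ sym (at-take w (<-≤-trans m<k k≤x)) ⟩
  at u m                       ≡⟨ sym (at-take u m<k) ⟩
  at (take k u) m              ≡⟨ cong (λ v → at v m) border ⟩
  at (drop (length u ∸ k) u) m ≡⟨ at-drop u (length u ∸ k) m ⟩
  at u (length u ∸ k + m)      ≡⟨ cong (λ d → at u (d ∸ k + m)) |u|≡x ⟩
  at u (x ∸ k + m)             ≡⟨ at-take w in-prefix ⟩
  at w (x ∸ k + m)             ∎
  where
  open ≡-Reasoning
  u = take x w
  |u|≡x : length u ≡ x
  |u|≡x = trans (LP.length-take x w) (m≤n⇒m⊓n≡m x≤n)
  in-prefix : x ∸ k + m < x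
  in-prefix = subst (x ∸ k + m <_) (m∸n+n≡m k≤x) (+-monoʳ-< (x ∸ k) m<k)

maxBelow-sound : (P : ℕ → Bool) (b : ℕ) {k : ℕ} → maxBelow P b ≡ just k → k < b × T (P k)
maxBelow-sound P (suc b) e with P b in eq
maxBelow-sound P (suc b) refl | true = ≤-refl , subst T (sym eq) _
... | false = let k<b , pk = maxBelow-sound P b e in m≤n⇒m≤1+n k<b , pk

module _ {A : Set} (_≟_ : DecidableEquality A) where

  strong-border : List A → ℕ → ℕ → Bool
  strong-border w i k = borderᵇ _≟_ (take i w) k ∧ not ⌊ MP.≡-dec _≟_ (at w k) (at w i) ⌋

  strong-border-sound : (w : List A) (i k : ℕ) → T (strong-border w i k) →
                        IsBorderOfLength _≟_ (take i w) k × at w k ≢ at w i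
  strong-border-sound w i k holds =
    let is-border , differs = Equivalence.to (T-∧ {borderᵇ _≟_ (take i w) k}) holds
    in toWitness {a? = LP.≡-dec _≟_ (take k (take i w)) (drop (length (take i w) ∸ k) (take i w))} is-border ,
       toWitnessFalse {a? = MP.≡-dec _≟_ (at w k) (at w i)} differs

  π′-sound : (w : List A) {j k : ℕ} → j < length w → π′ _≟_ w j ≡ just k →
             k < j × IsBorderOfLength _≟_ (take j w) k × at w k ≢ at w j
  π′-sound w {suc j} {k} j<n e with suc j ≡ᵇ length w in last
  ... | true  = ⊥-elim (<-irrefl (≡ᵇ⇒≡ (suc j) (length w) (subst T (sym last) _)) j<n)
  ... | false =
    let k<j , strong = maxBelow-sound (strong-border w (suc j)) (suc j) e
    in k<j , strong-border-sound w (suc j) k strong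

  π′-step-gap : (w : List A) {x y z : ℕ} → x < length w →
                π′ _≟_ w x ≡ just y → π′ _≟_ w y ≡ just z → z < y × y + z < x
  π′-step-gap w {x} {y} {z} x<n ex ey = z<y , gap
    where
    sx = π′-sound w x<n ex
    y<x = proj₁ sx
    border-y = proj₁ (proj₂ sx)
    y<n = <-trans y<x x<n
    sy = π′-sound w y<n ey
    z<y = proj₁ sy
    border-z = proj₁ (proj₂ sy)
    letter-differs = proj₂ (proj₂ sy)
    -- Otherwise x ≤ y + z and the two periods force w[z] = w[y].
    gap : y + z < x
    gap with y + z <? x
    ... | yes y+z<x = y+z<x
    ... | no  y+z≮x = ⊥-elim (letter-differs (nested-periods-agree (at w) z<y y<x
                        (≮⇒≥ y+z≮x) (border⇒periodic _≟_ w (<⇒≤ x<n) (<⇒≤ y<x) border-y)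
                        (border⇒periodic _≟_ w (<⇒≤ y<n) (<⇒≤ z<y) border-z)))

twice-below : ∀ {x y z} → z < y → y + z < x → 2 * suc z < suc x
twice-below {x} {y} {z} z<y gap = s≤s (begin
  suc z + (suc z + 0) ≡⟨ cong (suc z +_) (+-identityʳ (suc z)) ⟩
  suc z + suc z       ≤⟨ +-monoˡ-≤ (suc z) z<y ⟩
  y + suc z           ≡⟨ +-suc y z ⟩
  suc (y + z)         ≤⟨ gap ⟩
  x                   ∎)
  where open ≤-Reasoning

lemma3 : {A : Set} (_≟_ : DecidableEquality A) (w : List A) (i : ℕ) →
         1 ≤ i → i ≤ length w →
         1 ≤ f′ _≟_ w i → 1 ≤ f′ _≟_ w (f′ _≟_ w i) →
         2 * f′ _≟_ w (f′ _≟_ w (f′ _≟_ w i)) < f′ _≟_ w i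
lemma3 _≟_ w (suc i) _ i<n f′≥1 f′²≥1 with π′ _≟_ w i in ex
... | nothing = ⊥-elim (<-irrefl refl f′≥1)
... | just x with π′ _≟_ w x in ey
... | nothing = ⊥-elim (<-irrefl refl f′²≥1)
... | just y with π′ _≟_ w y in ez
... | nothing = s≤s z≤n
... | just z = let z<y , gap = π′-step-gap _≟_ w x<n ey ez in twice-below z<y gap
  where
  x<n : x < length w
  x<n = <-trans (proj₁ (π′-sound _≟_ w i<n ex)) i<n
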